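{- Let $\pi=(\pi_1,\ldots,\pi_k)$ be a partition of the nonnegative integer $r$ and $\tau=(\tau_1,\ldots,\tau_\ell)$ a partition of the nonnegative integer $s$. Then \[\sum_{i=1}^k\sum_{j=1}^\ell \min(\pi_i,\tau_j)\ \ge\ \min(r,s).\]
   Context: A partition of a nonnegative integer $r$ is a tuple $(\pi_1,\ldots,\pi_k)$ of positive integers with $r=\pi_1+\cdots+\pi_k$. -}

module Defs where

open import Data.Nat using (ℕ; _<_; _⊓_)
open import Data.List using (List; map)
open import Data.Nat.ListAction using (sum)
open import Data.List.Relation.Unary.All using (All)
open import Data.Product using (_×_)
open import Relation.Binary.PropositionalEquality using (_≡_)

IsPartition : ℕ → List ℕ → Set
IsPartition r π = All (0 <_) π × sum π ≡ r

minSum : List ℕ → List ℕ → ℕ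
minSum π τ = sum (map (λ p → sum (map (λ t → p ⊓ t) τ)) π)

-- Meeting with a fixed p is subadditive, p ⊓ (a + b) ≤ p ⊓ a + p ⊓ b, hence
-- p ⊓ (t₁ + ⋯ + tₗ) ≤ Σⱼ p ⊓ tⱼ.  Applying this twice gives
-- r ⊓ s = s ⊓ Σᵢ πᵢ ≤ Σᵢ πᵢ ⊓ s ≤ Σᵢ Σⱼ πᵢ ⊓ τⱼ.
module Submission where

open import Defs
open import Data.Nat using (ℕ; _≤_; _⊓_; _+_; z≤n)
open import Data.Nat.Properties
open import Data.List using (List; []; _∷_; map)
open import Data.Nat.ListAction using (sum)
open import Data.Product using (_,_)
open import Data.Sum using (inj₁; inj₂)
open import Relation.Binary.PropositionalEquality using (refl)

⊓-subadditiveʳ : ∀ p a b → p ⊓ (a + b) ≤ p ⊓ a + p ⊓ b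
⊓-subadditiveʳ p a b with ⊓-sel p a | ⊓-sel p b
... | inj₁ p⊓a≡p | _ rewrite p⊓a≡p = ≤-trans (m⊓n≤m p (a + b)) (m≤m+n p (p ⊓ b))
... | _ | inj₁ p⊓b≡p rewrite p⊓b≡p = ≤-trans (m⊓n≤m p (a + b)) (m≤n+m p (p ⊓ a))
... | inj₂ p⊓a≡a | inj₂ p⊓b≡b rewrite p⊓a≡a | p⊓b≡b = m⊓n≤n p (a + b)

⊓-sum-subadditive : ∀ p (xs : List ℕ) → p ⊓ sum xs ≤ sum (map (p ⊓_) xs)
⊓-sum-subadditive p []       = ≤-reflexive (⊓-zeroʳ p)
⊓-sum-subadditive p (x ∷ xs) =
  ≤-trans (⊓-subadditiveʳ p x (sum xs)) (+-monoʳ-≤ (p ⊓ x) (⊓-sum-subadditive p xs))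

sum-map-mono : ∀ {f g : ℕ → ℕ} → (∀ x → f x ≤ g x) → ∀ xs → sum (map f xs) ≤ sum (map g xs)
sum-map-mono f≤g []       = z≤n
sum-map-mono f≤g (x ∷ xs) = +-mono-≤ (f≤g x) (sum-map-mono f≤g xs)

lemma3p1 : (r s : ℕ) (π τ : List ℕ) → IsPartition r π → IsPartition s τ →
    r ⊓ s ≤ minSum π τ
lemma3p1 _ _ π τ (_ , refl) (_ , refl) = begin
  sum π ⊓ sum τ                ≡⟨ ⊓-comm (sum π) (sum τ) ⟩
  sum τ ⊓ sum π                ≤⟨ ⊓-sum-subadditive (sum τ) π ⟩
  sum (map (sum τ ⊓_) π)       ≤⟨ sum-map-mono row-bound π ⟩
  minSum π τ                   ∎
  where
  open ≤-Reasoning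
  row-bound : ∀ p → sum τ ⊓ p ≤ sum (map (p ⊓_) τ)
  row-bound p = ≤-trans (≤-reflexive (⊓-comm (sum τ) p)) (⊓-sum-subadditive p τ)
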